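{- Let $n \geq 1$. Every tri-colored sum-free set in $\mathbb{F}_2^n$ has size at most $6\binom{n}{\lfloor n/3 \rfloor}$.
   Context: A tri-colored sum-free set in an abelian group $H$ is a collection $\{(a_i,b_i,c_i)\}_{i=1}^m$ of ordered triples in $H^3$ such that, for $i,j,k \in \{1,\ldots,m\}$, the equation $a_i+b_j+c_k=0$ holds if and only if $i=j=k$. Its size is $m$. -}

module Defs where

open import Data.Bool using (Bool; false; _xor_)
open import Data.Nat using (ℕ)
open import Data.Fin using (Fin)
open import Data.Vec using (Vec; zipWith; replicate)
open import Data.Product using (_×_)
open import Relation.Binary.PropositionalEquality using (_≡_)
open import Function.Bundles using (_⇔_)

F₂^ : ℕ → Set
F₂^ n = Vec Bool n

_⊕_ : ∀ {n} → F₂^ n → F₂^ n → F₂^ n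
_⊕_ = zipWith _xor_

infixl 6 _⊕_

𝟎 : ∀ {n} → F₂^ n
𝟎 = replicate _ false

IsTriColoredSumFree : ∀ {n m} → (Fin m → F₂^ n) → (Fin m → F₂^ n) → (Fin m → F₂^ n) → Set
IsTriColoredSumFree a b c =
  ∀ i j k → (a i ⊕ b j ⊕ c k ≡ 𝟎) ⇔ (i ≡ j × j ≡ k)

module Submission where

-- Over 𝔽₂ the indicator of a + b + c = 0 in 𝔽₂ⁿ is ∏ₗ (1 + aₗ + bₗ + cₗ), so sum-freeness makes
-- the tensor (i, j, k) ↦ [a i + b j + c k = 0] the diagonal tensor of size m. Expanding the
-- product gives monomials x^α y^β z^γ with disjoint supports, hence |α| + |β| + |γ| ≤ n and
-- some part has size at most d = ⌊n/3⌋. Assigning each monomial to its first such part and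
-- grouping by that part writes the tensor as a sum of 3 · Σ_{k ≤ d} C(n,k) slices, products
-- of a function of one index with a function of the other two. The diagonal tensor of size m
-- is not a sum of fewer than m slices (Gaussian elimination removes one index and one slice
-- at a time), and Σ_{k ≤ d} C(n,k) < 2 C(n,d) since C(n,k+1) ≥ 2 C(n,k) whenever 3k + 2 ≤ n.

open import Defs
open import Level using (Level; 0ℓ)
open import Data.Bool using (Bool; true; false; not; T; _∧_; _xor_)
import Data.Bool as Bool
open import Data.Bool.Properties
  using ( xor-∧-commutativeRing; xor-assoc; xor-identityʳ; not-involutive
        ; ∧-assoc; ∧-zeroʳ; ∧-conicalˡ; ∧-distribˡ-xor; ∧-distribʳ-xor )
open import Data.Nat using (ℕ; zero; suc; _+_; _*_; _/_; _%_; _<ᵇ_; _≤_; _<_; z≤n; s≤s)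
open import Data.Nat.DivMod using (m≡m%n+[m/n]*n; m%n<n; m/n*n≤m)
open import Data.Nat.Properties
  using ( ≤-refl; ≤-reflexive; ≤-trans; ≤-<-trans; <⇒≤; ≤⇒≯; ≮⇒≥; _<?_; <⇒<ᵇ; n≤1+n; m≤n+m
        ; +-assoc; +-identityʳ; +-suc; +-mono-≤; +-monoˡ-≤; +-monoˡ-<; +-cancelʳ-≤
        ; *-comm; *-assoc; *-suc; *-zeroʳ; *-monoˡ-≤; *-monoʳ-≤; *-cancelˡ-≤; module ≤-Reasoning )
open import Data.Nat.Combinatorics using (_C_; nC1≡n; nCk+nC[k+1]≡[n+1]C[k+1])
open import Data.Fin using (Fin; zero; suc; _≟_)
open import Data.Fin.Subset using (Subset; inside; outside; ∣_∣)
open import Data.Vec using (Vec; []; _∷_)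
open import Data.Vec.Properties using (≡-dec)
open import Data.List using (List; []; _∷_; map; length; _++_; concatMap)
open import Data.List.Properties using (length-map; length-++; length-removeAt′)
open import Data.List.Relation.Unary.Any using (Any; here; there; index)
open import Data.List.Relation.Unary.All using (All; []; _∷_)
import Data.List.Relation.Unary.All as All
open import Data.List.Relation.Unary.All.Properties using (concat⁺; map⁺)
open import Data.List.Membership.Propositional using (_∈_; _─_; find)
open import Data.List.Membership.Propositional.Properties using (∈-map⁺)
open import Data.Product using (_×_; _,_)
open import Data.Sum using (_⊎_; inj₁; inj₂)
import Data.Sum as Sum
open import Function using (_∘_; flip)
open import Function.Bundles using (mk⇔)
open import Relation.Nullary.Decidable using (Dec; yes; no; does; _×-dec_; does-⇔)
open import Relation.Nullary.Negation using (contradiction)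
open import Relation.Binary.PropositionalEquality
  using (_≡_; refl; sym; trans; cong; cong₂; subst; module ≡-Reasoning)
open import Tactic.RingSolver using (solve-∀)
open import Data.Nat.Tactic.RingSolver using () renaming (solve-∀ to ℕ-solve-∀)
open import Tactic.RingSolver.Core.AlmostCommutativeRing using (AlmostCommutativeRing; fromCommutativeRing)
open import Data.Maybe using (just; nothing)

private
  variable
    ℓ ℓ′ : Level
    A : Set ℓ
    B : Set ℓ′
    m n : ℕ

-- Bool with xor and ∧ is the field 𝔽₂. The ring solver cannot handle not, so identities
-- involving not b are stated with true xor b, which is definitionally equal.
𝔽₂ : AlmostCommutativeRing 0ℓ 0ℓ
𝔽₂ = fromCommutativeRing xor-∧-commutativeRing λ where
  false → just refl
  true  → nothing

xor-cancelˡ : ∀ x y → x xor x xor y ≡ y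
xor-cancelˡ false y = refl
xor-cancelˡ true  y = not-involutive y

∑ : List A → (A → Bool) → Bool
∑ []       f = false
∑ (x ∷ xs) f = f x xor ∑ xs f

syntax ∑ xs (λ x → e) = ∑[ x ∈ xs ] e

∑-cong : ∀ (xs : List A) {f g : A → Bool} → (∀ x → f x ≡ g x) → ∑ xs f ≡ ∑ xs g
∑-cong []       f≗g = refl
∑-cong (x ∷ xs) f≗g = cong₂ _xor_ (f≗g x) (∑-cong xs f≗g)

∑-cong-All : ∀ {P : A → Set ℓ′} {xs : List A} {f g : A → Bool} →
             All P xs → (∀ {x} → P x → f x ≡ g x) → ∑ xs f ≡ ∑ xs g
∑-cong-All []         f≗g = refl
∑-cong-All (px ∷ pxs) f≗g = cong₂ _xor_ (f≗g px) (∑-cong-All pxs f≗g)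

∑-false : ∀ (xs : List A) → ∑[ x ∈ xs ] false ≡ false
∑-false []       = refl
∑-false (x ∷ xs) = ∑-false xs

∑-map : ∀ (h : A → B) (xs : List A) (f : B → Bool) → ∑ (map h xs) f ≡ ∑ xs (f ∘ h)
∑-map h []       f = refl
∑-map h (x ∷ xs) f = cong (f (h x) xor_) (∑-map h xs f)

∑-++ : ∀ (xs ys : List A) (f : A → Bool) → ∑ (xs ++ ys) f ≡ ∑ xs f xor ∑ ys f
∑-++ []       ys f = refl
∑-++ (x ∷ xs) ys f = trans (cong (f x xor_) (∑-++ xs ys f)) (sym (xor-assoc (f x) _ _))

∑-concatMap : ∀ (h : A → List B) (xs : List A) (f : B → Bool) →
              ∑ (concatMap h xs) f ≡ ∑[ x ∈ xs ] ∑ (h x) f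
∑-concatMap h []       f = refl
∑-concatMap h (x ∷ xs) f = trans (∑-++ (h x) _ f) (cong (∑ (h x) f xor_) (∑-concatMap h xs f))

∑-xor : ∀ (xs : List A) (f g : A → Bool) → ∑[ x ∈ xs ] (f x xor g x) ≡ ∑ xs f xor ∑ xs g
∑-xor []       f g = refl
∑-xor (x ∷ xs) f g =
  trans (cong ((f x xor g x) xor_) (∑-xor xs f g)) (interchange (f x) (g x) (∑ xs f) (∑ xs g))
  where
  interchange : ∀ p q r s → (p xor q) xor (r xor s) ≡ (p xor r) xor (q xor s)
  interchange = solve-∀ 𝔽₂

∧-distribˡ-∑ : ∀ c (xs : List A) (f : A → Bool) → c ∧ ∑ xs f ≡ ∑[ x ∈ xs ] (c ∧ f x)
∧-distribˡ-∑ c []       f = ∧-zeroʳ c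
∧-distribˡ-∑ c (x ∷ xs) f = trans (∧-distribˡ-xor c (f x) _) (cong ((c ∧ f x) xor_) (∧-distribˡ-∑ c xs f))

∧-distribʳ-∑ : ∀ c (xs : List A) (f : A → Bool) → ∑ xs f ∧ c ≡ ∑[ x ∈ xs ] (f x ∧ c)
∧-distribʳ-∑ c []       f = refl
∧-distribʳ-∑ c (x ∷ xs) f = trans (∧-distribʳ-xor c (f x) _) (cong ((f x ∧ c) xor_) (∧-distribʳ-∑ c xs f))

∑-comm : ∀ (xs : List A) (ys : List B) (h : A → B → Bool) →
         ∑[ x ∈ xs ] ∑[ y ∈ ys ] h x y ≡ ∑[ y ∈ ys ] ∑[ x ∈ xs ] h x y
∑-comm []       ys h = sym (∑-false ys)
∑-comm (x ∷ xs) ys h = trans (cong (∑ ys (h x) xor_) (∑-comm xs ys h)) (sym (∑-xor ys (h x) _))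

∑-─ : ∀ {x} {xs : List A} (x∈xs : x ∈ xs) (f : A → Bool) → ∑ xs f ≡ f x xor ∑ (xs ─ x∈xs) f
∑-─ (here refl)               f = refl
∑-─ {x = x} {y ∷ xs} (there x∈xs) f =
  trans (cong (f y xor_) (∑-─ x∈xs f)) (swap (f y) (f x) _)
  where
  swap : ∀ p q r → p xor q xor r ≡ q xor p xor r
  swap = solve-∀ 𝔽₂

∑≡true⇒Any : ∀ (xs : List A) {f : A → Bool} → ∑ xs f ≡ true → Any (λ x → f x ≡ true) xs
∑≡true⇒Any (x ∷ xs) {f} ∑≡true with f x in fx≡
... | true  = here fx≡
... | false = there (∑≡true⇒Any xs ∑≡true)

-- Slice rank of the diagonal

Tensor : ℕ → Set
Tensor m = Fin m → Fin m → Fin m → Bool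

data Slice (m : ℕ) : Set where
  slice₁ slice₂ slice₃ : (Fin m → Bool) → (Fin m → Fin m → Bool) → Slice m

⟦_⟧ : Slice m → Tensor m
⟦ slice₁ f g ⟧ i j k = f i ∧ g j k
⟦ slice₂ f g ⟧ i j k = f j ∧ g i k
⟦ slice₃ f g ⟧ i j k = f k ∧ g i j

IsSliceDecomposition : List (Slice m) → Tensor m → Set
IsSliceDecomposition ss T = ∀ i j k → ∑[ s ∈ ss ] ⟦ s ⟧ i j k ≡ T i j k

diagonal : Tensor m
diagonal i j k = does (i ≟ j ×-dec j ≟ k)

swap₁₂ swap₁₃ : Slice m → Slice m
swap₁₂ (slice₁ f g) = slice₂ f g
swap₁₂ (slice₂ f g) = slice₁ f g
swap₁₂ (slice₃ f g) = slice₃ f (flip g)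
swap₁₃ (slice₁ f g) = slice₃ f (flip g)
swap₁₃ (slice₂ f g) = slice₂ f (flip g)
swap₁₃ (slice₃ f g) = slice₁ f (flip g)

⟦swap₁₂⟧ : ∀ (s : Slice m) i j k → ⟦ swap₁₂ s ⟧ i j k ≡ ⟦ s ⟧ j i k
⟦swap₁₂⟧ (slice₁ f g) i j k = refl
⟦swap₁₂⟧ (slice₂ f g) i j k = refl
⟦swap₁₂⟧ (slice₃ f g) i j k = refl

⟦swap₁₃⟧ : ∀ (s : Slice m) i j k → ⟦ swap₁₃ s ⟧ i j k ≡ ⟦ s ⟧ k j i
⟦swap₁₃⟧ (slice₁ f g) i j k = refl
⟦swap₁₃⟧ (slice₂ f g) i j k = refl
⟦swap₁₃⟧ (slice₃ f g) i j k = refl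

swap₁₂-diagonal : ∀ (ss : List (Slice m)) → IsSliceDecomposition ss diagonal →
                  IsSliceDecomposition (map swap₁₂ ss) diagonal
swap₁₂-diagonal ss ss≡δ i j k = begin
  ∑[ s ∈ map swap₁₂ ss ] ⟦ s ⟧ i j k  ≡⟨ ∑-map swap₁₂ ss _ ⟩
  ∑[ s ∈ ss ] ⟦ swap₁₂ s ⟧ i j k      ≡⟨ ∑-cong ss (λ s → ⟦swap₁₂⟧ s i j k) ⟩
  ∑[ s ∈ ss ] ⟦ s ⟧ j i k             ≡⟨ ss≡δ j i k ⟩
  diagonal j i k                      ≡⟨ does-⇔ (mk⇔ flip₁₂ flip₁₂) (j ≟ i ×-dec i ≟ k) (i ≟ j ×-dec j ≟ k) ⟩
  diagonal i j k                      ∎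
  where
  open ≡-Reasoning
  flip₁₂ : ∀ {i j k : Fin _} → i ≡ j × j ≡ k → j ≡ i × i ≡ k
  flip₁₂ (i≡j , j≡k) = sym i≡j , trans i≡j j≡k

swap₁₃-diagonal : ∀ (ss : List (Slice m)) → IsSliceDecomposition ss diagonal →
                  IsSliceDecomposition (map swap₁₃ ss) diagonal
swap₁₃-diagonal ss ss≡δ i j k = begin
  ∑[ s ∈ map swap₁₃ ss ] ⟦ s ⟧ i j k  ≡⟨ ∑-map swap₁₃ ss _ ⟩
  ∑[ s ∈ ss ] ⟦ swap₁₃ s ⟧ i j k      ≡⟨ ∑-cong ss (λ s → ⟦swap₁₃⟧ s i j k) ⟩
  ∑[ s ∈ ss ] ⟦ s ⟧ k j i             ≡⟨ ss≡δ k j i ⟩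
  diagonal k j i                      ≡⟨ does-⇔ (mk⇔ flip₁₃ flip₁₃) (k ≟ j ×-dec j ≟ i) (i ≟ j ×-dec j ≟ k) ⟩
  diagonal i j k                      ∎
  where
  open ≡-Reasoning
  flip₁₃ : ∀ {i j k : Fin _} → i ≡ j × j ≡ k → k ≡ j × j ≡ i
  flip₁₃ (i≡j , j≡k) = sym j≡k , sym i≡j

-- Row reduction along the first index with pivot 0: add f u times the layer i = 0 and drop
-- the index 0. Slices stay slices; if f 0 ≡ true the layer of slice₁ f g cancels that slice,
-- while the diagonal has no entry with i = 0 and j ≠ 0.
module Elimination (f : Fin (suc m) → Bool) where

  private
    pull-outʳ : ∀ p x y z → ((p ∧ x) xor y) ∧ z ≡ (p ∧ (x ∧ z)) xor (y ∧ z)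
    pull-outʳ = solve-∀ 𝔽₂

    pull-outˡ : ∀ p x y z → x ∧ ((p ∧ y) xor z) ≡ (p ∧ (x ∧ y)) xor (x ∧ z)
    pull-outˡ = solve-∀ 𝔽₂

  eliminate : Tensor (suc m) → Tensor m
  eliminate T u v w = (f (suc u) ∧ T zero (suc v) (suc w)) xor T (suc u) (suc v) (suc w)

  eliminateSlice : Slice (suc m) → Slice m
  eliminateSlice (slice₁ h g) =
    slice₁ (λ u → (f (suc u) ∧ h zero) xor h (suc u)) (λ v w → g (suc v) (suc w))
  eliminateSlice (slice₂ h g) =
    slice₂ (h ∘ suc) (λ u w → (f (suc u) ∧ g zero (suc w)) xor g (suc u) (suc w))
  eliminateSlice (slice₃ h g) =
    slice₃ (h ∘ suc) (λ u v → (f (suc u) ∧ g zero (suc v)) xor g (suc u) (suc v))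

  ⟦eliminateSlice⟧ : ∀ s u v w → ⟦ eliminateSlice s ⟧ u v w ≡ eliminate ⟦ s ⟧ u v w
  ⟦eliminateSlice⟧ (slice₁ h g) u v w =
    pull-outʳ (f (suc u)) (h zero) (h (suc u)) (g (suc v) (suc w))
  ⟦eliminateSlice⟧ (slice₂ h g) u v w =
    pull-outˡ (f (suc u)) (h (suc v)) (g zero (suc w)) (g (suc u) (suc w))
  ⟦eliminateSlice⟧ (slice₃ h g) u v w =
    pull-outˡ (f (suc u)) (h (suc w)) (g zero (suc v)) (g (suc u) (suc v))

  ∑-eliminateSlice : ∀ (ss : List (Slice (suc m))) u v w →
    ∑[ s ∈ map eliminateSlice ss ] ⟦ s ⟧ u v w ≡ eliminate (λ i j k → ∑[ s ∈ ss ] ⟦ s ⟧ i j k) u v w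
  ∑-eliminateSlice ss u v w = begin
    ∑[ s ∈ map eliminateSlice ss ] ⟦ s ⟧ u v w
      ≡⟨ ∑-map eliminateSlice ss _ ⟩
    ∑[ s ∈ ss ] ⟦ eliminateSlice s ⟧ u v w
      ≡⟨ ∑-cong ss (λ s → ⟦eliminateSlice⟧ s u v w) ⟩
    ∑[ s ∈ ss ] ((f (suc u) ∧ ⟦ s ⟧ zero (suc v) (suc w)) xor ⟦ s ⟧ (suc u) (suc v) (suc w))
      ≡⟨ ∑-xor ss _ _ ⟩
    ∑[ s ∈ ss ] (f (suc u) ∧ ⟦ s ⟧ zero (suc v) (suc w)) xor ∑[ s ∈ ss ] ⟦ s ⟧ (suc u) (suc v) (suc w)
      ≡⟨ cong (_xor _) (∧-distribˡ-∑ (f (suc u)) ss _) ⟨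
    eliminate (λ i j k → ∑[ s ∈ ss ] ⟦ s ⟧ i j k) u v w
      ∎
    where open ≡-Reasoning

  pivot-elimination : ∀ {g} {ss : List (Slice (suc m))} (p : slice₁ f g ∈ ss) → f zero ≡ true →
                      IsSliceDecomposition ss diagonal →
                      IsSliceDecomposition (map eliminateSlice (ss ─ p)) diagonal
  pivot-elimination {g} {ss} p f₀≡true ss≡δ u v w = begin
    ∑[ s ∈ map eliminateSlice (ss ─ p) ] ⟦ s ⟧ u v w
      ≡⟨ ∑-eliminateSlice (ss ─ p) u v w ⟩
    (f (suc u) ∧ ∑[ s ∈ ss ─ p ] ⟦ s ⟧ zero (suc v) (suc w))
      xor ∑[ s ∈ ss ─ p ] ⟦ s ⟧ (suc u) (suc v) (suc w)
      ≡⟨ cong₂ (λ x y → (f (suc u) ∧ x) xor y)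
               (rest zero (suc v) (suc w)) (rest (suc u) (suc v) (suc w)) ⟩
    (f (suc u) ∧ ((f zero ∧ G) xor false)) xor (f (suc u) ∧ G) xor diagonal u v w
      ≡⟨ cong (λ x → (f (suc u) ∧ ((x ∧ G) xor false)) xor (f (suc u) ∧ G) xor diagonal u v w) f₀≡true ⟩
    (f (suc u) ∧ (G xor false)) xor (f (suc u) ∧ G) xor diagonal u v w
      ≡⟨ cong (λ x → (f (suc u) ∧ x) xor (f (suc u) ∧ G) xor diagonal u v w) (xor-identityʳ G) ⟩
    (f (suc u) ∧ G) xor (f (suc u) ∧ G) xor diagonal u v w
      ≡⟨ xor-cancelˡ (f (suc u) ∧ G) (diagonal u v w) ⟩
    diagonal u v w
      ∎
    where
    open ≡-Reasoning
    G : Bool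
    G = g (suc v) (suc w)
    rest : ∀ i j k → ∑[ s ∈ ss ─ p ] ⟦ s ⟧ i j k ≡ (f i ∧ g j k) xor diagonal i j k
    rest i j k = begin
      ∑[ s ∈ ss ─ p ] ⟦ s ⟧ i j k
        ≡⟨ xor-cancelˡ (f i ∧ g j k) _ ⟨
      (f i ∧ g j k) xor (f i ∧ g j k) xor ∑[ s ∈ ss ─ p ] ⟦ s ⟧ i j k
        ≡⟨ cong ((f i ∧ g j k) xor_) (∑-─ p (λ s → ⟦ s ⟧ i j k)) ⟨
      (f i ∧ g j k) xor ∑[ s ∈ ss ] ⟦ s ⟧ i j k
        ≡⟨ cong ((f i ∧ g j k) xor_) (ss≡δ i j k) ⟩
      (f i ∧ g j k) xor diagonal i j k
        ∎

open Elimination using (eliminateSlice; pivot-elimination)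

rank-step : ∀ {f g} {ss : List (Slice (suc m))} →
            (∀ (ts : List (Slice m)) → IsSliceDecomposition ts diagonal → m ≤ length ts) →
            slice₁ f g ∈ ss → f zero ≡ true → IsSliceDecomposition ss diagonal → suc m ≤ length ss
rank-step {m} {f} {ss = ss} rank p f₀≡true ss≡δ = begin
  suc m                   ≤⟨ s≤s (rank reduced (pivot-elimination f p f₀≡true ss≡δ)) ⟩
  suc (length reduced)    ≡⟨ cong suc (length-map (eliminateSlice f) (ss ─ p)) ⟩
  suc (length (ss ─ p))   ≡⟨ length-removeAt′ ss (index p) ⟨
  length ss               ∎
  where
  open ≤-Reasoning
  reduced : List (Slice m)
  reduced = map (eliminateSlice f) (ss ─ p)

-- The diagonal entry at (0, 0, 0) forces a slice whose one-index factor is true at 0;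
-- a transposition of the indices makes it a slice₁.
diagonal-rank : ∀ (ss : List (Slice m)) → IsSliceDecomposition ss diagonal → m ≤ length ss
diagonal-rank {zero}  ss ss≡δ = z≤n
diagonal-rank {suc m} ss ss≡δ with find (∑≡true⇒Any ss (ss≡δ zero zero zero))
... | slice₁ f g , p , f₀g₀₀≡true =
  rank-step diagonal-rank p (∧-conicalˡ _ _ f₀g₀₀≡true) ss≡δ
... | slice₂ f g , p , f₀g₀₀≡true =
  subst (suc m ≤_) (length-map swap₁₂ ss)
    (rank-step diagonal-rank (∈-map⁺ swap₁₂ p) (∧-conicalˡ _ _ f₀g₀₀≡true) (swap₁₂-diagonal ss ss≡δ))
... | slice₃ f g , p , f₀g₀₀≡true =
  subst (suc m ≤_) (length-map swap₁₃ ss)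
    (rank-step diagonal-rank (∈-map⁺ swap₁₃ p) (∧-conicalˡ _ _ f₀g₀₀≡true) (swap₁₃-diagonal ss ss≡δ))

-- Expansion of the indicator of zero

infix 4 _≟ᵛ_

_≟ᵛ_ : (u v : Vec Bool n) → Dec (u ≡ v)
_≟ᵛ_ = ≡-dec Bool._≟_

isZero : F₂^ n → Bool
isZero v = does (v ≟ᵛ 𝟎)

infix 8 _^_

_^_ : F₂^ n → Subset n → Bool
[]       ^ []            = true
(x ∷ xs) ^ (inside  ∷ S) = x ∧ xs ^ S
(x ∷ xs) ^ (outside ∷ S) = xs ^ S

record Monomial (n : ℕ) : Set where
  constructor monomial
  field
    α β γ : Subset n

open Monomial

⟦_⟧ᵐ : Monomial n → F₂^ n → F₂^ n → F₂^ n → Bool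
⟦ t ⟧ᵐ x y z = x ^ α t ∧ y ^ β t ∧ z ^ γ t

degree : Monomial n → ℕ
degree t = ∣ α t ∣ + ∣ β t ∣ + ∣ γ t ∣

data Summand : Set where
  𝟏 𝐱 𝐲 𝐳 : Summand

summands : List Summand
summands = 𝟏 ∷ 𝐱 ∷ 𝐲 ∷ 𝐳 ∷ []

⟦_⟧ˢ : Summand → Bool → Bool → Bool → Bool
⟦ 𝟏 ⟧ˢ x y z = true
⟦ 𝐱 ⟧ˢ x y z = x
⟦ 𝐲 ⟧ˢ x y z = y
⟦ 𝐳 ⟧ˢ x y z = z

infixr 5 _∷ᵐ_

_∷ᵐ_ : Summand → Monomial n → Monomial (suc n)
𝟏 ∷ᵐ monomial α β γ = monomial (outside ∷ α) (outside ∷ β) (outside ∷ γ)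
𝐱 ∷ᵐ monomial α β γ = monomial (inside ∷ α)  (outside ∷ β) (outside ∷ γ)
𝐲 ∷ᵐ monomial α β γ = monomial (outside ∷ α) (inside ∷ β)  (outside ∷ γ)
𝐳 ∷ᵐ monomial α β γ = monomial (outside ∷ α) (outside ∷ β) (inside ∷ γ)

expansion : ∀ n → List (Monomial n)
expansion zero    = monomial [] [] [] ∷ []
expansion (suc n) = concatMap (λ c → map (c ∷ᵐ_) (expansion n)) summands

⟦∷ᵐ⟧ : ∀ c (t : Monomial n) x y z xs ys zs →
       ⟦ c ∷ᵐ t ⟧ᵐ (x ∷ xs) (y ∷ ys) (z ∷ zs) ≡ ⟦ c ⟧ˢ x y z ∧ ⟦ t ⟧ᵐ xs ys zs
⟦∷ᵐ⟧ 𝟏 t x y z xs ys zs = refl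
⟦∷ᵐ⟧ 𝐱 t x y z xs ys zs = ∧-assoc x _ _
⟦∷ᵐ⟧ 𝐲 t x y z xs ys zs = shift (xs ^ α t) y (ys ^ β t) (zs ^ γ t)
  where
  shift : ∀ p y q r → p ∧ (y ∧ q) ∧ r ≡ y ∧ p ∧ q ∧ r
  shift = solve-∀ 𝔽₂
⟦∷ᵐ⟧ 𝐳 t x y z xs ys zs = shift (xs ^ α t) (ys ^ β t) z (zs ^ γ t)
  where
  shift : ∀ p q z r → p ∧ q ∧ z ∧ r ≡ z ∧ p ∧ q ∧ r
  shift = solve-∀ 𝔽₂

does-≟false : ∀ b → does (b Bool.≟ false) ≡ not b
does-≟false false = refl
does-≟false true  = refl

∑-expansion : ∀ n (x y z : F₂^ n) → ∑[ t ∈ expansion n ] ⟦ t ⟧ᵐ x y z ≡ isZero (x ⊕ y ⊕ z)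
∑-expansion zero    []       []       []       = refl
∑-expansion (suc n) (x ∷ xs) (y ∷ ys) (z ∷ zs) = begin
  ∑[ t ∈ expansion (suc n) ] value t
    ≡⟨ ∑-concatMap (λ c → map (c ∷ᵐ_) (expansion n)) summands value ⟩
  ∑[ c ∈ summands ] ∑[ t ∈ map (c ∷ᵐ_) (expansion n) ] value t
    ≡⟨ ∑-cong summands (λ c → ∑-map (c ∷ᵐ_) (expansion n) value) ⟩
  ∑[ c ∈ summands ] ∑[ t ∈ expansion n ] value (c ∷ᵐ t)
    ≡⟨ ∑-cong summands (λ c → ∑-cong (expansion n) (λ t → ⟦∷ᵐ⟧ c t x y z xs ys zs)) ⟩
  ∑[ c ∈ summands ] ∑[ t ∈ expansion n ] (⟦ c ⟧ˢ x y z ∧ ⟦ t ⟧ᵐ xs ys zs)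
    ≡⟨ ∑-cong summands (λ c → ∧-distribˡ-∑ (⟦ c ⟧ˢ x y z) (expansion n) (λ t → ⟦ t ⟧ᵐ xs ys zs)) ⟨
  ∑[ c ∈ summands ] (⟦ c ⟧ˢ x y z ∧ E)
    ≡⟨ factor x y z E ⟩
  not ((x xor y) xor z) ∧ E
    ≡⟨ cong₂ _∧_ (sym (does-≟false ((x xor y) xor z))) (∑-expansion n xs ys zs) ⟩
  isZero ((x ∷ xs) ⊕ (y ∷ ys) ⊕ (z ∷ zs))
    ∎
  where
  open ≡-Reasoning
  value : Monomial (suc n) → Bool
  value t = ⟦ t ⟧ᵐ (x ∷ xs) (y ∷ ys) (z ∷ zs)
  E : Bool
  E = ∑[ t ∈ expansion n ] ⟦ t ⟧ᵐ xs ys zs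
  factor : ∀ x y z e →
           (true ∧ e) xor (x ∧ e) xor (y ∧ e) xor (z ∧ e) xor false ≡ (true xor (x xor y) xor z) ∧ e
  factor = solve-∀ 𝔽₂

degree-∷ᵐ : ∀ c (t : Monomial n) → degree (c ∷ᵐ t) ≤ suc (degree t)
degree-∷ᵐ 𝟏 t = n≤1+n (degree t)
degree-∷ᵐ 𝐱 t = ≤-refl
degree-∷ᵐ 𝐲 t = ≤-reflexive (cong (_+ ∣ γ t ∣) (+-suc ∣ α t ∣ ∣ β t ∣))
degree-∷ᵐ 𝐳 t = ≤-reflexive (+-suc (∣ α t ∣ + ∣ β t ∣) ∣ γ t ∣)

degree-expansion : ∀ n → All (λ t → degree t ≤ n) (expansion n)
degree-expansion zero    = z≤n ∷ []
degree-expansion (suc n) = concat⁺ (extend 𝟏 ∷ extend 𝐱 ∷ extend 𝐲 ∷ extend 𝐳 ∷ [])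
  where
  extend : ∀ c → All (λ t → degree t ≤ suc n) (map (c ∷ᵐ_) (expansion n))
  extend c = map⁺ (All.map (λ {t} deg≤n → ≤-trans (degree-∷ᵐ c t) (s≤s deg≤n)) (degree-expansion n))

-- Grouping the monomials by a small part

lowSubsets : ∀ n → ℕ → List (Subset n)
lowSubsets n       zero    = []
lowSubsets zero    (suc r) = [] ∷ []
lowSubsets (suc n) (suc r) = map (inside ∷_) (lowSubsets n r) ++ map (outside ∷_) (lowSubsets n (suc r))

∑-lowSubsets-≟ : ∀ n r (S : Subset n) → ∑[ κ ∈ lowSubsets n r ] does (S ≟ᵛ κ) ≡ (∣ S ∣ <ᵇ r)
∑-lowSubsets-≟ n       zero    S       = refl
∑-lowSubsets-≟ zero    (suc r) []      = refl
∑-lowSubsets-≟ (suc n) (suc r) (s ∷ S) = begin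
  ∑[ κ ∈ lowSubsets (suc n) (suc r) ] does ((s ∷ S) ≟ᵛ κ)
    ≡⟨ ∑-++ (map (inside ∷_) (lowSubsets n r)) _ (λ κ → does ((s ∷ S) ≟ᵛ κ)) ⟩
  ∑[ κ ∈ map (inside ∷_) (lowSubsets n r) ] does ((s ∷ S) ≟ᵛ κ)
    xor ∑[ κ ∈ map (outside ∷_) (lowSubsets n (suc r)) ] does ((s ∷ S) ≟ᵛ κ)
    ≡⟨ cong₂ _xor_ (∑-≟-∷ inside (lowSubsets n r)) (∑-≟-∷ outside (lowSubsets n (suc r))) ⟩
  (does (s Bool.≟ inside) ∧ ∑[ κ ∈ lowSubsets n r ] does (S ≟ᵛ κ))
    xor (does (s Bool.≟ outside) ∧ ∑[ κ ∈ lowSubsets n (suc r) ] does (S ≟ᵛ κ))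
    ≡⟨ cong₂ (λ p q → (does (s Bool.≟ inside) ∧ p) xor (does (s Bool.≟ outside) ∧ q))
             (∑-lowSubsets-≟ n r S) (∑-lowSubsets-≟ n (suc r) S) ⟩
  (does (s Bool.≟ inside) ∧ (∣ S ∣ <ᵇ r)) xor (does (s Bool.≟ outside) ∧ (∣ S ∣ <ᵇ suc r))
    ≡⟨ select s ⟩
  ∣ s ∷ S ∣ <ᵇ suc r
    ∎
  where
  open ≡-Reasoning
  ∑-≟-∷ : ∀ s′ (κs : List (Subset n)) →
          ∑[ κ ∈ map (s′ ∷_) κs ] does ((s ∷ S) ≟ᵛ κ) ≡ does (s Bool.≟ s′) ∧ ∑[ κ ∈ κs ] does (S ≟ᵛ κ)
  ∑-≟-∷ s′ κs =
    trans (∑-map (s′ ∷_) κs _) (sym (∧-distribˡ-∑ (does (s Bool.≟ s′)) κs (λ κ → does (S ≟ᵛ κ))))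
  select : ∀ s → (does (s Bool.≟ inside) ∧ (∣ S ∣ <ᵇ r)) xor (does (s Bool.≟ outside) ∧ (∣ S ∣ <ᵇ suc r))
                ≡ (∣ s ∷ S ∣ <ᵇ suc r)
  select inside  = xor-identityʳ _
  select outside = refl

regroup : ∀ (ts : List A) (S : A → Subset n) (w : A → Bool) (x : F₂^ n) r →
          ∑[ κ ∈ lowSubsets n r ] (x ^ κ ∧ ∑[ t ∈ ts ] (does (S t ≟ᵛ κ) ∧ w t))
            ≡ ∑[ t ∈ ts ] ((∣ S t ∣ <ᵇ r) ∧ x ^ S t ∧ w t)
regroup {n = n} ts S w x r = begin
  ∑[ κ ∈ K ] (x ^ κ ∧ ∑[ t ∈ ts ] (does (S t ≟ᵛ κ) ∧ w t))
    ≡⟨ ∑-cong K (λ κ → ∧-distribˡ-∑ (x ^ κ) ts _) ⟩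
  ∑[ κ ∈ K ] ∑[ t ∈ ts ] (x ^ κ ∧ does (S t ≟ᵛ κ) ∧ w t)
    ≡⟨ ∑-cong K (λ κ → ∑-cong ts (λ t → evaluate-at (S t) κ (w t))) ⟩
  ∑[ κ ∈ K ] ∑[ t ∈ ts ] (does (S t ≟ᵛ κ) ∧ x ^ S t ∧ w t)
    ≡⟨ ∑-comm K ts _ ⟩
  ∑[ t ∈ ts ] ∑[ κ ∈ K ] (does (S t ≟ᵛ κ) ∧ x ^ S t ∧ w t)
    ≡⟨ ∑-cong ts (λ t → ∧-distribʳ-∑ (x ^ S t ∧ w t) K (λ κ → does (S t ≟ᵛ κ))) ⟨
  ∑[ t ∈ ts ] ((∑[ κ ∈ K ] does (S t ≟ᵛ κ)) ∧ x ^ S t ∧ w t)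
    ≡⟨ ∑-cong ts (λ t → cong (_∧ x ^ S t ∧ w t) (∑-lowSubsets-≟ n r (S t))) ⟩
  ∑[ t ∈ ts ] ((∣ S t ∣ <ᵇ r) ∧ x ^ S t ∧ w t)
    ∎
  where
  open ≡-Reasoning
  K : List (Subset n)
  K = lowSubsets n r
  evaluate-at : ∀ S′ κ v → x ^ κ ∧ does (S′ ≟ᵛ κ) ∧ v ≡ does (S′ ≟ᵛ κ) ∧ x ^ S′ ∧ v
  evaluate-at S′ κ v with S′ ≟ᵛ κ
  ... | yes refl = refl
  ... | no  _    = ∧-zeroʳ (x ^ κ)

pigeonhole : ∀ {p q s r} → p + q + s < 3 * r → p < r ⊎ q < r ⊎ s < r
pigeonhole {p} {q} {s} {r} sum<3r with p <? r | q <? r | s <? r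
... | yes p<r | _       | _       = inj₁ p<r
... | no _    | yes q<r | _       = inj₂ (inj₁ q<r)
... | no _    | no _    | yes s<r = inj₂ (inj₂ s<r)
... | no p≮r  | no q≮r  | no s≮r  = contradiction sum<3r (≤⇒≯ (begin
  3 * r            ≡⟨ +-assoc r r (r + 0) ⟨
  r + r + (r + 0)  ≡⟨ cong (r + r +_) (+-identityʳ r) ⟩
  r + r + r        ≤⟨ +-mono-≤ (+-mono-≤ (≮⇒≥ p≮r) (≮⇒≥ q≮r)) (≮⇒≥ s≮r) ⟩
  p + q + s        ∎))
  where open ≤-Reasoning

partition-of-unity : ∀ p q s → T p ⊎ T q ⊎ T s → p xor (not p ∧ q) xor (not p ∧ not q ∧ s) ≡ true
partition-of-unity true  q     s     _                = refl
partition-of-unity false true  s     _                = refl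
partition-of-unity false false true  _                = refl
partition-of-unity false false false (inj₁ ())
partition-of-unity false false false (inj₂ (inj₁ ()))
partition-of-unity false false false (inj₂ (inj₂ ()))

select-first-small : ∀ p q s A B C → T p ⊎ T q ⊎ T s →
  (p ∧ A ∧ B ∧ C) xor (q ∧ B ∧ not p ∧ A ∧ C) xor (s ∧ C ∧ not p ∧ not q ∧ A ∧ B) ≡ A ∧ B ∧ C
select-first-small p q s A B C one-small =
  trans (factor p q s A B C) (cong (_∧ A ∧ B ∧ C) (partition-of-unity p q s one-small))
  where
  factor : ∀ p q s A B C →
    (p ∧ A ∧ B ∧ C) xor (q ∧ B ∧ (true xor p) ∧ A ∧ C) xor (s ∧ C ∧ (true xor p) ∧ (true xor q) ∧ A ∧ B)
      ≡ (p xor ((true xor p) ∧ q) xor ((true xor p) ∧ (true xor q) ∧ s)) ∧ A ∧ B ∧ C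
  factor = solve-∀ 𝔽₂

-- For n < 3 r every monomial of the expansion has a part of size < r. It is assigned to its
-- first such part in the order x, y, z; the factors not (small …) exclude monomials already
-- assigned to an earlier part.
module SumFreeSlices {n m} (a b c : Fin m → F₂^ n) (r : ℕ) where

  small : Subset n → Bool
  small S = ∣ S ∣ <ᵇ r

  sliceˣ sliceʸ sliceᶻ : Subset n → Slice m
  sliceˣ κ = slice₁ (λ i → a i ^ κ) λ j k →
    ∑[ t ∈ expansion n ] (does (α t ≟ᵛ κ) ∧ b j ^ β t ∧ c k ^ γ t)
  sliceʸ κ = slice₂ (λ j → b j ^ κ) λ i k →
    ∑[ t ∈ expansion n ] (does (β t ≟ᵛ κ) ∧ not (small (α t)) ∧ a i ^ α t ∧ c k ^ γ t)
  sliceᶻ κ = slice₃ (λ k → c k ^ κ) λ i j →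
    ∑[ t ∈ expansion n ]
      (does (γ t ≟ᵛ κ) ∧ not (small (α t)) ∧ not (small (β t)) ∧ a i ^ α t ∧ b j ^ β t)

  slices : List (Slice m)
  slices = map sliceˣ (lowSubsets n r) ++ map sliceʸ (lowSubsets n r) ++ map sliceᶻ (lowSubsets n r)

  length-slices : length slices ≡ 3 * length (lowSubsets n r)
  length-slices = begin
    length slices
      ≡⟨ length-++ (map sliceˣ K) ⟩
    length (map sliceˣ K) + length (map sliceʸ K ++ map sliceᶻ K)
      ≡⟨ cong (length (map sliceˣ K) +_) (length-++ (map sliceʸ K)) ⟩
    length (map sliceˣ K) + (length (map sliceʸ K) + length (map sliceᶻ K))
      ≡⟨ cong₂ _+_ (length-map sliceˣ K) (cong₂ _+_ (length-map sliceʸ K) (length-map sliceᶻ K)) ⟩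
    length K + (length K + length K)
      ≡⟨ cong (λ l → length K + (length K + l)) (+-identityʳ (length K)) ⟨
    3 * length K
      ∎
    where
    open ≡-Reasoning
    K : List (Subset n)
    K = lowSubsets n r

  one-part-small : n < 3 * r → ∀ {t : Monomial n} → degree t ≤ n →
                   T (small (α t)) ⊎ T (small (β t)) ⊎ T (small (γ t))
  one-part-small n<3r {t} deg≤n =
    Sum.map (<⇒small (α t)) (Sum.map (<⇒small (β t)) (<⇒small (γ t)))
            (pigeonhole (≤-<-trans deg≤n n<3r))
    where
    <⇒small : ∀ S → ∣ S ∣ < r → T (small S)
    <⇒small S = <⇒<ᵇ

  slices-decompose : n < 3 * r → IsSliceDecomposition slices (λ i j k → isZero (a i ⊕ b j ⊕ c k))
  slices-decompose n<3r i j k = begin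
    ∑[ s ∈ slices ] ⟦ s ⟧ i j k
      ≡⟨ ∑-++ (map sliceˣ K) _ eval ⟩
    ∑ (map sliceˣ K) eval xor ∑ (map sliceʸ K ++ map sliceᶻ K) eval
      ≡⟨ cong (∑ (map sliceˣ K) eval xor_) (∑-++ (map sliceʸ K) _ eval) ⟩
    ∑ (map sliceˣ K) eval xor ∑ (map sliceʸ K) eval xor ∑ (map sliceᶻ K) eval
      ≡⟨ cong₂ _xor_ (trans (∑-map sliceˣ K eval) (regroup E α _ (a i) r))
           (cong₂ _xor_ (trans (∑-map sliceʸ K eval) (regroup E β _ (b j) r))
                        (trans (∑-map sliceᶻ K eval) (regroup E γ _ (c k) r))) ⟩
    ∑ E X₁ xor ∑ E X₂ xor ∑ E X₃
      ≡⟨ cong (∑ E X₁ xor_) (∑-xor E X₂ X₃) ⟨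
    ∑ E X₁ xor ∑[ t ∈ E ] (X₂ t xor X₃ t)
      ≡⟨ ∑-xor E X₁ _ ⟨
    ∑[ t ∈ E ] (X₁ t xor X₂ t xor X₃ t)
      ≡⟨ ∑-cong-All (degree-expansion n) (λ {t} deg≤n →
           select-first-small _ _ _ (a i ^ α t) (b j ^ β t) (c k ^ γ t)
                              (one-part-small n<3r {t} deg≤n)) ⟩
    ∑[ t ∈ E ] ⟦ t ⟧ᵐ (a i) (b j) (c k)
      ≡⟨ ∑-expansion n (a i) (b j) (c k) ⟩
    isZero (a i ⊕ b j ⊕ c k)
      ∎
    where
    open ≡-Reasoning
    K : List (Subset n)
    K = lowSubsets n r
    E : List (Monomial n)
    E = expansion n
    eval : Slice m → Bool
    eval s = ⟦ s ⟧ i j k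
    X₁ X₂ X₃ : Monomial n → Bool
    X₁ t = small (α t) ∧ a i ^ α t ∧ b j ^ β t ∧ c k ^ γ t
    X₂ t = small (β t) ∧ b j ^ β t ∧ not (small (α t)) ∧ a i ^ α t ∧ c k ^ γ t
    X₃ t = small (γ t) ∧ c k ^ γ t ∧ not (small (α t)) ∧ not (small (β t)) ∧ a i ^ α t ∧ b j ^ β t

open SumFreeSlices using (slices; length-slices; slices-decompose)

-- Counting the slices

[k+1]*nC[k+1]+k*nCk≡n*nCk : ∀ n k → suc k * (n C suc k) + k * (n C k) ≡ n * (n C k)
[k+1]*nC[k+1]+k*nCk≡n*nCk zero    zero    = refl
[k+1]*nC[k+1]+k*nCk≡n*nCk zero    (suc k) = cong₂ _+_ (*-zeroʳ (suc (suc k))) (*-zeroʳ (suc k))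
[k+1]*nC[k+1]+k*nCk≡n*nCk (suc n) zero    = begin
  1 * (suc n C 1) + 0 * (suc n C 0)  ≡⟨ +-identityʳ _ ⟩
  1 * (suc n C 1)                    ≡⟨ cong (1 *_) (nC1≡n (suc n)) ⟩
  1 * suc n                          ≡⟨ *-comm 1 (suc n) ⟩
  suc n * (suc n C 0)                ∎
  where open ≡-Reasoning
[k+1]*nC[k+1]+k*nCk≡n*nCk (suc n) (suc k) = begin
  suc (suc k) * (suc n C suc (suc k)) + suc k * (suc n C suc k)
    ≡⟨ cong₂ (λ p q → suc (suc k) * p + suc k * q)
             (nCk+nC[k+1]≡[n+1]C[k+1] n (suc k)) (nCk+nC[k+1]≡[n+1]C[k+1] n k) ⟨
  suc (suc k) * (Y + Z) + suc k * (X + Y)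
    ≡⟨ rearrange k X Y Z ⟩
  (suc (suc k) * Z + suc k * Y) + (suc k * Y + k * X) + (X + Y)
    ≡⟨ cong₂ (λ p q → p + q + (X + Y))
             ([k+1]*nC[k+1]+k*nCk≡n*nCk n (suc k)) ([k+1]*nC[k+1]+k*nCk≡n*nCk n k) ⟩
  n * Y + n * X + (X + Y)
    ≡⟨ collect n X Y ⟩
  suc n * (X + Y)
    ≡⟨ cong (suc n *_) (nCk+nC[k+1]≡[n+1]C[k+1] n k) ⟩
  suc n * (suc n C suc k)
    ∎
  where
  open ≡-Reasoning
  X Y Z : ℕ
  X = n C k
  Y = n C suc k
  Z = n C suc (suc k)
  rearrange : ∀ k x y z → (2 + k) * (y + z) + (1 + k) * (x + y)
                          ≡ ((2 + k) * z + (1 + k) * y) + ((1 + k) * y + k * x) + (x + y)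
  rearrange = ℕ-solve-∀
  collect : ∀ n x y → n * y + n * x + (x + y) ≡ (1 + n) * (x + y)
  collect = ℕ-solve-∀

2*nCk≤nC[k+1] : ∀ n k → 2 + 3 * k ≤ n → 2 * (n C k) ≤ n C suc k
2*nCk≤nC[k+1] n k 2+3k≤n = *-cancelˡ-≤ (suc k) (+-cancelʳ-≤ (k * (n C k)) _ _ (begin
  suc k * (2 * (n C k)) + k * (n C k)  ≡⟨ expand k (n C k) ⟩
  (2 + 3 * k) * (n C k)                ≤⟨ *-monoˡ-≤ (n C k) 2+3k≤n ⟩
  n * (n C k)                          ≡⟨ [k+1]*nC[k+1]+k*nCk≡n*nCk n k ⟨
  suc k * (n C suc k) + k * (n C k)    ∎))
  where
  open ≤-Reasoning
  expand : ∀ k x → (1 + k) * (2 * x) + k * x ≡ (2 + 3 * k) * x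
  expand = ℕ-solve-∀

length-lowSubsets : ∀ n r → length (lowSubsets n (suc r)) ≡ length (lowSubsets n r) + n C r
length-lowSubsets zero    zero    = refl
length-lowSubsets zero    (suc r) = refl
length-lowSubsets (suc n) zero    =
  trans (length-map (outside ∷_) (lowSubsets n 1)) (length-lowSubsets n zero)
length-lowSubsets (suc n) (suc r) = begin
  length (lowSubsets (suc n) (suc (suc r)))
    ≡⟨ length-split (suc r) ⟩
  length (lowSubsets n (suc r)) + length (lowSubsets n (suc (suc r)))
    ≡⟨ cong₂ _+_ (length-lowSubsets n r) (length-lowSubsets n (suc r)) ⟩
  (length (lowSubsets n r) + n C r) + (length (lowSubsets n (suc r)) + n C suc r)
    ≡⟨ interchange (length (lowSubsets n r)) (n C r) (length (lowSubsets n (suc r))) (n C suc r) ⟩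
  (length (lowSubsets n r) + length (lowSubsets n (suc r))) + (n C r + n C suc r)
    ≡⟨ cong₂ _+_ (length-split r) (sym (nCk+nC[k+1]≡[n+1]C[k+1] n r)) ⟨
  length (lowSubsets (suc n) (suc r)) + suc n C suc r
    ∎
  where
  open ≡-Reasoning
  length-split : ∀ r → length (lowSubsets (suc n) (suc r))
                        ≡ length (lowSubsets n r) + length (lowSubsets n (suc r))
  length-split r = trans (length-++ (map (inside ∷_) (lowSubsets n r)))
                         (cong₂ _+_ (length-map _ (lowSubsets n r)) (length-map _ (lowSubsets n (suc r))))
  interchange : ∀ w x y z → (w + x) + (y + z) ≡ (w + y) + (x + z)
  interchange = ℕ-solve-∀

length-lowSubsets< : ∀ n d → 3 * d ≤ n → length (lowSubsets n (suc d)) < 2 * (n C d)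
length-lowSubsets< n zero    _         = ≤-reflexive (cong suc (length-lowSubsets n zero))
length-lowSubsets< n (suc d) 3[1+d]≤n = begin-strict
  length (lowSubsets n (suc (suc d)))        ≡⟨ length-lowSubsets n (suc d) ⟩
  length (lowSubsets n (suc d)) + n C suc d  <⟨ +-monoˡ-< (n C suc d) (length-lowSubsets< n d 3d≤n) ⟩
  2 * (n C d) + n C suc d                    ≤⟨ +-monoˡ-≤ (n C suc d) (2*nCk≤nC[k+1] n d 2+3d≤n) ⟩
  n C suc d + n C suc d                      ≡⟨ cong (n C suc d +_) (+-identityʳ (n C suc d)) ⟨
  2 * (n C suc d)                            ∎
  where
  open ≤-Reasoning
  2+3d≤n : 2 + 3 * d ≤ n
  2+3d≤n = ≤-trans (n≤1+n _) (subst (_≤ n) (*-suc 3 d) 3[1+d]≤n)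
  3d≤n : 3 * d ≤ n
  3d≤n = ≤-trans (m≤n+m (3 * d) 2) 2+3d≤n

n<3*[1+n/3] : ∀ n → n < 3 * suc (n / 3)
n<3*[1+n/3] n = begin-strict
  n                  ≡⟨ m≡m%n+[m/n]*n n 3 ⟩
  n % 3 + n / 3 * 3  <⟨ +-monoˡ-< (n / 3 * 3) (m%n<n n 3) ⟩
  3 + n / 3 * 3      ≡⟨ cong (3 +_) (*-comm (n / 3) 3) ⟩
  3 + 3 * (n / 3)    ≡⟨ *-suc 3 (n / 3) ⟨
  3 * suc (n / 3)    ∎
  where open ≤-Reasoning

mainTheorem2 : (n : ℕ) → 1 ≤ n → (m : ℕ) → (a b c : Fin m → F₂^ n) →
    IsTriColoredSumFree a b c → m ≤ 6 * (n C (n / 3))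
mainTheorem2 n _ m a b c sum-free = begin
  m                                       ≤⟨ diagonal-rank (slices a b c r) decomposition ⟩
  length (slices a b c r)                 ≡⟨ length-slices a b c r ⟩
  3 * length (lowSubsets n r)             ≤⟨ *-monoʳ-≤ 3 (<⇒≤ (length-lowSubsets< n d 3d≤n)) ⟩
  3 * (2 * (n C d))                       ≡⟨ *-assoc 3 2 (n C d) ⟨
  6 * (n C d)                             ∎
  where
  open ≤-Reasoning
  d r : ℕ
  d = n / 3
  r = suc d
  3d≤n : 3 * d ≤ n
  3d≤n = subst (_≤ n) (*-comm d 3) (m/n*n≤m n 3)
  decomposition : IsSliceDecomposition (slices a b c r) diagonal
  decomposition i j k = trans (slices-decompose a b c r (n<3*[1+n/3] n) i j k)
                              (does-⇔ (sum-free i j k) (a i ⊕ b j ⊕ c k ≟ᵛ 𝟎) (i ≟ j ×-dec j ≟ k))
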